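{- Let $n > t \ge 0$ be integers. Suppose $a_1,\dots,a_m,b_1,\dots,b_m \in \{0,1\}^n$ satisfy, for all $i \in [m]$, $\mathrm{dist}(a_i,b_i) = t + s_i$ for some integer $s_i \ge 1$, and $\mathrm{dist}(a_i,b_j) + \mathrm{dist}(a_j,b_i) \le 2t$ for all distinct $i,j \in [m]$. Then $$\sum_{i=1}^m \frac{V_{t+s_i,s_i}}{2^{t+s_i}} \le 1.$$ In particular, $f'(t;\{0,1\}) \le 2^{t+1}$, and if $s \ge 1$ is such that $s_i \ge s$ for all $i \in [m]$, then $m \le 2^{t+s}/V_{t+s,s}$; consequently $f'(t,s;\{0,1\}) \le 2^{t+s}/V_{t+s,s}$.
   Context: For $p,q \in \{0,1\}^n$, $\mathrm{dist}(p,q)$ is the Hamming distance (number of coordinates in which they differ). For integers $1 \le d \le n$, $V_{n,d} = \sum_{i=0}^{(d-1)/2} \binom{n}{i}$ if $d$ is odd, and $V_{n,d} = \sum_{i=0}^{d/2-1} \binom{n}{i} + \binom{n-1}{d/2-1}$ if $d$ is even. For a set $X$, $f'(t;X)$ is the maximum $m$ such that there exist $n > t$ and $a_1,\dots,a_m,b_1,\dots,b_m \in X^n$ with $\mathrm{dist}(a_i,b_i) \ge t+1$ for all $i$ and $\mathrm{dist}(a_i,b_j)+\mathrm{dist}(a_j,b_i) \le 2t$ for all distinct $i,j$. For $s \ge 1$, $f'(t,s;X)$ is defined the same way but with $\mathrm{dist}(a_i,b_i) \ge t+s$ in place of $\mathrm{dist}(a_i,b_i) \ge t+1$. -}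

module Defs where

open import Data.Bool using (Bool; true; false; if_then_else_; _xor_)
open import Data.Nat using (ℕ; zero; suc; _+_; _*_; _∸_; _^_; _≤_; _<_; _/_; _%_)
open import Data.Nat.Properties using (m^n≢0)
open import Data.Nat.Combinatorics using (_C_)
open import Data.Vec using (Vec; []; _∷_)
open import Data.Fin using (Fin)
open import Data.List using (List; upTo; allFin; foldr) renaming (map to lmap)
open import Data.Nat.ListAction using (sum)
open import Data.Integer using (+_)
open import Data.Rational using (ℚ; 0ℚ) renaming (_+_ to _+ℚ_; _/_ to _/ℚ_)
open import Relation.Binary.PropositionalEquality using (_≡_; _≢_)

dist : ∀ {n} → Vec Bool n → Vec Bool n → ℕ
dist [] [] = 0
dist (x ∷ p) (y ∷ q) = (if x xor y then 1 else 0) + dist p q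

binSum : ℕ → ℕ → ℕ
binSum n k = sum (lmap (n C_) (upTo k))

V : ℕ → ℕ → ℕ
V n d with d % 2
... | zero  = binSum n (d / 2) + ((n ∸ 1) C ((d / 2) ∸ 1))
... | suc _ = binSum n (((d ∸ 1) / 2) + 1)

Vfrac : ℕ → ℕ → ℚ
Vfrac k d = _/ℚ_ (+ V k d) (2 ^ k) {{m^n≢0 2 k}}

Σℚ : ∀ {m} → (Fin m → ℚ) → ℚ
Σℚ {m} f = foldr _+ℚ_ 0ℚ (lmap f (allFin m))

Cross : ∀ {n m} → ℕ → (Fin m → Vec Bool n) → (Fin m → Vec Bool n) → Set
Cross {m = m} t a b = (i j : Fin m) → i ≢ j → dist (a i) (b j) + dist (a j) (b i) ≤ 2 * t

-- Fix a pair (a, b) at distance d = t + s and call the coordinates where a and b differ steps. If x agrees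
-- with b on p of the steps, then dist x b + 2p = d + dist x a. The ball of (a, b) consists of the x with
-- 2p < s, together with those with 2p = s that agree with b on the first step; splitting the cube along
-- that first step shows it has exactly V_{d,s} 2^(n-d) points. Every x in the ball has
-- dist x b ≥ dist x a + t, so by the triangle inequality a common point of the balls of two pairs i ≠ j
-- forces dist aᵢ bⱼ + dist aⱼ bᵢ ≥ 2t, strictly unless 2p = s for both pairs; and then the first steps
-- make one of the two triangle inequalities strict. Hence the balls are disjoint, which is the main
-- inequality, and the bounds on m follow because V_{t+s,s} / 2^(t+s) increases with s.

module Submission where

open import Defs
open import Data.Bool using (Bool; true; false; if_then_else_; _xor_; T)
open import Data.Empty using (⊥; ⊥-elim)
open import Data.Fin using (Fin; zero; suc)
import Data.Fin.Properties as Fin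
import Data.Integer as ℤ
import Data.Integer.Properties as ℤ
open import Data.Integer.Tactic.RingSolver using () renaming (solve-∀ to ℤ-solve-∀)
open import Data.List using (upTo; [_]; _++_; foldr) renaming (map to lmap)
open import Data.List.Properties using (upTo-∷ʳ; map-++; map-tabulate)
open import Data.Nat
open import Data.Nat.Combinatorics using (_C_; nCk+nC[k+1]≡[n+1]C[k+1]; nC1≡n)
open import Data.Nat.DivMod using (m*n/n≡m; [m+kn]%n≡m%n; m*n%n≡0)
open import Data.Nat.ListAction using (sum)
open import Data.Nat.ListAction.Properties using (sum-++)
open import Data.Nat.Properties
open import Data.Nat.Tactic.RingSolver using (solve-∀)
open import Algebra.Properties.CommutativeSemigroup +-commutativeSemigroup using (interchange; x∙yz≈xz∙y; xy∙z≈xz∙y)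
import Algebra.Properties.CommutativeSemigroup *-commutativeSemigroup as *-CS
import Algebra.Properties.Semiring.Sum +-*-semiring as ∑
open ∑ using (sum-syntax)
open import Data.Product using (_×_; _,_)
open import Data.Rational using (1ℚ) renaming (_≤_ to _≤ℚ_)
import Data.Rational as ℚ
open import Data.Rational.Properties using (toℚᵘ-fromℚᵘ; toℚᵘ-injective; toℚᵘ-homo-+; toℚᵘ-cancel-≤)
open import Data.Rational.Unnormalised using (mkℚᵘ; *≡*; *≤*) renaming (_/_ to _/ᵘ_; _+_ to _+ᵘ_; _≃_ to _≃ᵘ_)
import Data.Rational.Unnormalised.Properties as ℚᵘ
open import Data.Vec using (Vec; []; _∷_)
open import Function using (_∘′_)
open import Relation.Binary.PropositionalEquality
  using (_≡_; refl; sym; trans; cong; cong₂; subst; subst₂; module ≡-Reasoning)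
open import Relation.Nullary using (yes; no)

-- Partial binomial sums and V

binSum-suc : ∀ N r → binSum N (suc r) ≡ binSum N r + N C r
binSum-suc N r = begin
  sum (lmap (N C_) (upTo (suc r)))         ≡⟨ cong (sum ∘′ lmap (N C_)) (upTo-∷ʳ r) ⟨
  sum (lmap (N C_) (upTo r ++ [ r ]))      ≡⟨ cong sum (map-++ (N C_) (upTo r) [ r ]) ⟩
  sum (lmap (N C_) (upTo r) ++ [ N C r ])  ≡⟨ sum-++ (lmap (N C_) (upTo r)) [ N C r ] ⟩
  binSum N r + (N C r + 0)                 ≡⟨ cong (binSum N r +_) (+-identityʳ (N C r)) ⟩
  binSum N r + N C r                       ∎
  where open ≡-Reasoning

binSum-zero : ∀ r → binSum 0 (suc r) ≡ 1
binSum-zero zero    = refl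
binSum-zero (suc r) = begin
  binSum 0 (suc (suc r))   ≡⟨ binSum-suc 0 (suc r) ⟩
  binSum 0 (suc r) + 0     ≡⟨ +-identityʳ _ ⟩
  binSum 0 (suc r)         ≡⟨ binSum-zero r ⟩
  1                        ∎
  where open ≡-Reasoning

binSum-pascal : ∀ N r → binSum (suc N) (suc r) ≡ binSum N (suc r) + binSum N r
binSum-pascal N zero    = refl
binSum-pascal N (suc r) = begin
  binSum (suc N) (suc (suc r))                           ≡⟨ binSum-suc (suc N) (suc r) ⟩
  binSum (suc N) (suc r) + suc N C suc r                 ≡⟨ cong₂ _+_ (binSum-pascal N r) pascal ⟩
  (binSum N (suc r) + binSum N r) + (N C suc r + N C r)  ≡⟨ interchange (binSum N (suc r)) (binSum N r) (N C suc r) (N C r) ⟩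
  (binSum N (suc r) + N C suc r) + (binSum N r + N C r)  ≡⟨ cong₂ _+_ (binSum-suc N (suc r)) (binSum-suc N r) ⟨
  binSum N (suc (suc r)) + binSum N (suc r)              ∎
  where
  open ≡-Reasoning
  pascal : suc N C suc r ≡ N C suc r + N C r
  pascal = trans (sym (nCk+nC[k+1]≡[n+1]C[k+1] N r)) (+-comm (N C r) (N C suc r))

data PositiveParity : ℕ → Set where
  odd  : ∀ k → PositiveParity (suc (k * 2))
  even : ∀ k → PositiveParity (suc k * 2)

positiveParity : ∀ {s} → 1 ≤ s → PositiveParity s
positiveParity {suc zero}          _ = odd 0
positiveParity {suc (suc zero)}    _ = even 0
positiveParity {suc (suc (suc s))} _ with positiveParity {suc s} (s≤s z≤n)
... | odd k  = odd (suc k)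
... | even k = even (suc k)

V-odd : ∀ N k → V (suc N) (suc (k * 2)) ≡ binSum N (suc k) + binSum N k
V-odd N k = begin
  V (suc N) (suc (k * 2))          ≡⟨ V-oddBranch (suc N) (suc (k * 2)) ([m+kn]%n≡m%n 1 k 2) ⟩
  binSum (suc N) (k * 2 / 2 + 1)   ≡⟨ cong (λ r → binSum (suc N) (r + 1)) (m*n/n≡m k 2) ⟩
  binSum (suc N) (k + 1)           ≡⟨ cong (binSum (suc N)) (+-comm k 1) ⟩
  binSum (suc N) (suc k)           ≡⟨ binSum-pascal N k ⟩
  binSum N (suc k) + binSum N k    ∎
  where
  open ≡-Reasoning
  V-oddBranch : ∀ M d → d % 2 ≡ 1 → V M d ≡ binSum M ((d ∸ 1) / 2 + 1)
  V-oddBranch M d eq rewrite eq = refl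

V-even : ∀ N k → V (suc N) (suc k * 2) ≡ binSum N (suc k) + binSum N (suc k)
V-even N k = begin
  V (suc N) (suc k * 2)                         ≡⟨ V-evenBranch (suc N) (suc k * 2) (m*n%n≡0 (suc k) 2) ⟩
  binSum (suc N) (suc k * 2 / 2) + N C (suc k * 2 / 2 ∸ 1)
                                                ≡⟨ cong (λ r → binSum (suc N) r + N C (r ∸ 1)) (m*n/n≡m (suc k) 2) ⟩
  binSum (suc N) (suc k) + N C k                ≡⟨ cong (_+ N C k) (binSum-pascal N k) ⟩
  (binSum N (suc k) + binSum N k) + N C k       ≡⟨ +-assoc (binSum N (suc k)) (binSum N k) (N C k) ⟩
  binSum N (suc k) + (binSum N k + N C k)       ≡⟨ cong (binSum N (suc k) +_) (binSum-suc N k) ⟨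
  binSum N (suc k) + binSum N (suc k)           ∎
  where
  open ≡-Reasoning
  V-evenBranch : ∀ M d → d % 2 ≡ 0 → V M d ≡ binSum M (d / 2) + (M ∸ 1) C (d / 2 ∸ 1)
  V-evenBranch M d eq rewrite eq = refl

⌊k*2/2⌋≡k : ∀ k → ⌊ k * 2 /2⌋ ≡ k
⌊k*2/2⌋≡k zero    = refl
⌊k*2/2⌋≡k (suc k) = cong suc (⌊k*2/2⌋≡k k)

⌊1+k*2/2⌋≡k : ∀ k → ⌊ suc (k * 2) /2⌋ ≡ k
⌊1+k*2/2⌋≡k zero    = refl
⌊1+k*2/2⌋≡k (suc k) = cong suc (⌊1+k*2/2⌋≡k k)

V-halves : ∀ N {s} → 1 ≤ s → V (suc N) s ≡ binSum N ⌈ s /2⌉ + binSum N ⌊ s /2⌋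
V-halves N s≥1 with positiveParity s≥1
... | odd k  = trans (V-odd N k)
                 (cong₂ (λ c f → binSum N c + binSum N f) (cong suc (sym (⌊k*2/2⌋≡k k))) (sym (⌊1+k*2/2⌋≡k k)))
... | even k = trans (V-even N k)
                 (cong₂ (λ c f → binSum N c + binSum N f) (cong suc (sym (⌊1+k*2/2⌋≡k k))) (cong suc (sym (⌊k*2/2⌋≡k k))))

[k+1]*nC[k+1]+k*nCk≡n*nCk : ∀ n k → suc k * (n C suc k) + k * (n C k) ≡ n * (n C k)
[k+1]*nC[k+1]+k*nCk≡n*nCk zero    zero    = refl
[k+1]*nC[k+1]+k*nCk≡n*nCk zero    (suc k) = cong₂ _+_ (*-zeroʳ (suc (suc k))) (*-zeroʳ (suc k))
[k+1]*nC[k+1]+k*nCk≡n*nCk (suc n) zero    =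
  trans (+-identityʳ _) (trans (*-identityˡ _) (trans (nC1≡n (suc n)) (sym (*-identityʳ (suc n)))))
[k+1]*nC[k+1]+k*nCk≡n*nCk (suc n) (suc k) = begin
  suc (suc k) * (suc n C suc (suc k)) + suc k * (suc n C suc k)
    ≡⟨ cong₂ (λ u v → suc (suc k) * u + suc k * v) (pascal (suc k)) (pascal k) ⟨
  suc (suc k) * (c₁ + c₂) + suc k * (c₀ + c₁)
    ≡⟨ regroup k c₀ c₁ c₂ ⟩
  (suc (suc k) * c₂ + suc k * c₁) + c₁ + (suc k * c₁ + k * c₀) + c₀
    ≡⟨ cong₂ (λ u v → u + c₁ + v + c₀) ([k+1]*nC[k+1]+k*nCk≡n*nCk n (suc k)) ([k+1]*nC[k+1]+k*nCk≡n*nCk n k) ⟩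
  n * c₁ + c₁ + n * c₀ + c₀
    ≡⟨ collect n c₀ c₁ ⟩
  suc n * (c₀ + c₁)
    ≡⟨ cong (suc n *_) (pascal k) ⟩
  suc n * (suc n C suc k) ∎
  where
  open ≡-Reasoning
  c₀ = n C k
  c₁ = n C suc k
  c₂ = n C suc (suc k)
  pascal : ∀ j → n C j + n C suc j ≡ suc n C suc j
  pascal = nCk+nC[k+1]≡[n+1]C[k+1] n
  regroup : ∀ k x y z → suc (suc k) * (y + z) + suc k * (x + y)
                      ≡ (suc (suc k) * z + suc k * y) + y + (suc k * y + k * x) + x
  regroup = solve-∀
  collect : ∀ n x y → n * y + y + n * x + x ≡ suc n * (x + y)
  collect = solve-∀

k*2<n⇒nCk≤nC[k+1] : ∀ {n k} → k * 2 < n → n C k ≤ n C suc k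
k*2<n⇒nCk≤nC[k+1] {n} {k} k*2<n = *-cancelˡ-≤ (suc k) (+-cancelʳ-≤ (k * (n C k)) _ _ (begin
  suc k * (n C k) + k * (n C k)        ≡⟨ *-distribʳ-+ (n C k) (suc k) k ⟨
  (suc k + k) * (n C k)                ≤⟨ *-monoˡ-≤ (n C k) (≤-trans (≤-reflexive (k+k≡k*2 k)) k*2<n) ⟩
  n * (n C k)                          ≡⟨ [k+1]*nC[k+1]+k*nCk≡n*nCk n k ⟨
  suc k * (n C suc k) + k * (n C k)    ∎))
  where
  open ≤-Reasoning
  k+k≡k*2 : ∀ k → suc k + k ≡ suc (k * 2)
  k+k≡k*2 = solve-∀

2*V[N,s]≤V[1+N,1+s] : ∀ {N s} → 1 ≤ s → s ≤ N → 2 * V N s ≤ V (suc N) (suc s)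
2*V[N,s]≤V[1+N,1+s] {zero}  (s≤s z≤n) ()
2*V[N,s]≤V[1+N,1+s] {suc N} s≥1 s≤N with positiveParity s≥1
... | odd k  = ≤-reflexive (begin
  2 * V (suc N) (suc (k * 2))                       ≡⟨ cong (2 *_) (V-odd N k) ⟩
  2 * (A₁ + A₀)                                     ≡⟨ cong (A₁ + A₀ +_) (+-identityʳ (A₁ + A₀)) ⟩
  (A₁ + A₀) + (A₁ + A₀)                             ≡⟨ cong₂ _+_ (binSum-pascal N k) (binSum-pascal N k) ⟨
  binSum (suc N) (suc k) + binSum (suc N) (suc k)   ≡⟨ V-even (suc N) k ⟨
  V (suc (suc N)) (suc k * 2)                       ∎)
  where
  open ≡-Reasoning
  A₀ = binSum N k
  A₁ = binSum N (suc k)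
... | even k = begin
  2 * V (suc N) (suc k * 2)                               ≡⟨ cong (2 *_) (V-even N k) ⟩
  2 * (A₁ + A₁)                                           ≡⟨ cong (A₁ + A₁ +_) (+-identityʳ (A₁ + A₁)) ⟩
  (A₁ + A₁) + (A₁ + A₁)                                   ≤⟨ +-monoˡ-≤ (A₁ + A₁) middle ⟩
  (A₂ + A₀) + (A₁ + A₁)                                   ≡⟨ interchange A₂ A₀ A₁ A₁ ⟩
  (A₂ + A₁) + (A₀ + A₁)                                   ≡⟨ cong ((A₂ + A₁) +_) (+-comm A₀ A₁) ⟩
  (A₂ + A₁) + (A₁ + A₀)                                   ≡⟨ cong₂ _+_ (binSum-pascal N (suc k)) (binSum-pascal N k) ⟨
  binSum (suc N) (suc (suc k)) + binSum (suc N) (suc k)   ≡⟨ V-odd (suc N) (suc k) ⟨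
  V (suc (suc N)) (suc (suc k * 2))                       ∎
  where
  open ≤-Reasoning
  A₀ = binSum N k
  A₁ = binSum N (suc k)
  A₂ = binSum N (suc (suc k))
  middle : A₁ + A₁ ≤ A₂ + A₀
  middle = begin
    A₁ + A₁                 ≡⟨ cong (A₁ +_) (binSum-suc N k) ⟩
    A₁ + (A₀ + N C k)       ≤⟨ +-monoʳ-≤ A₁ (+-monoʳ-≤ A₀ (k*2<n⇒nCk≤nC[k+1] (s≤s⁻¹ s≤N))) ⟩
    A₁ + (A₀ + N C suc k)   ≡⟨ x∙yz≈xz∙y A₁ A₀ (N C suc k) ⟩
    (A₁ + N C suc k) + A₀   ≡⟨ cong (_+ A₀) (binSum-suc N (suc k)) ⟨
    A₂ + A₀                 ∎

V-ratio-mono : ∀ t {s s′} → 1 ≤ s → s ≤ s′ → V (t + s) s * 2 ^ (t + s′) ≤ V (t + s′) s′ * 2 ^ (t + s)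
V-ratio-mono t {s} s≥1 s≤s′ = go (≤⇒≤′ s≤s′)
  where
  go : ∀ {s′} → s ≤′ s′ → V (t + s) s * 2 ^ (t + s′) ≤ V (t + s′) s′ * 2 ^ (t + s)
  go ≤′-refl                 = ≤-refl
  go (≤′-step {s′} s≤′s′) = begin
    V (t + s) s * 2 ^ (t + suc s′)        ≡⟨ cong (λ k → V (t + s) s * 2 ^ k) (+-suc t s′) ⟩
    V (t + s) s * (2 * 2 ^ (t + s′))      ≡⟨ *-CS.x∙yz≈y∙xz (V (t + s) s) 2 (2 ^ (t + s′)) ⟩
    2 * (V (t + s) s * 2 ^ (t + s′))      ≤⟨ *-monoʳ-≤ 2 (go s≤′s′) ⟩
    2 * (V (t + s′) s′ * 2 ^ (t + s))     ≡⟨ *-assoc 2 (V (t + s′) s′) (2 ^ (t + s)) ⟨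
    2 * V (t + s′) s′ * 2 ^ (t + s)       ≤⟨ *-monoˡ-≤ (2 ^ (t + s)) (2*V[N,s]≤V[1+N,1+s] s′≥1 (m≤n+m s′ t)) ⟩
    V (suc (t + s′)) (suc s′) * 2 ^ (t + s) ≡⟨ cong (λ k → V k (suc s′) * 2 ^ (t + s)) (+-suc t s′) ⟨
    V (t + suc s′) (suc s′) * 2 ^ (t + s) ∎
    where
    open ≤-Reasoning
    s′≥1 = ≤-trans s≥1 (≤′⇒≤ s≤′s′)

-- Counting points of the cube

count : ∀ n → (Vec Bool n → Bool) → ℕ
count zero    P = if P [] then 1 else 0
count (suc n) P = count n (λ x → P (false ∷ x)) + count n (λ x → P (true ∷ x))

count-cong : ∀ n {P Q : Vec Bool n → Bool} → (∀ x → P x ≡ Q x) → count n P ≡ count n Q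
count-cong zero    P≗Q = cong (λ b → if b then 1 else 0) (P≗Q [])
count-cong (suc n) P≗Q = cong₂ _+_ (count-cong n (λ x → P≗Q (false ∷ x))) (count-cong n (λ x → P≗Q (true ∷ x)))

count-false : ∀ n → count n (λ _ → false) ≡ 0
count-false zero    = refl
count-false (suc n) = cong₂ _+_ (count-false n) (count-false n)

record Density (n : ℕ) (P : Vec Bool n → Bool) (v D : ℕ) : Set where
  constructor density
  field
    count*2^D≡v*2^n : count n P * 2 ^ D ≡ v * 2 ^ n

density-cong : ∀ {n P Q v D} → (∀ x → P x ≡ Q x) → Density n P v D → Density n Q v D
density-cong {n} {D = D} P≗Q (density eq) = density (trans (cong (_* 2 ^ D) (sym (count-cong n P≗Q))) eq)

density-empty : ∀ {n D} → Density n (λ _ → false) 0 D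
density-empty {n} {D} = density (cong (_* 2 ^ D) (count-false n))

density-double : ∀ {n P v D} → Density n (λ x → P (false ∷ x)) v D → Density n (λ x → P (true ∷ x)) v D →
                 Density (suc n) P v D
density-double {n} {P} {v} {D} (density eq₀) (density eq₁) = density (begin
  (c₀ + c₁) * 2 ^ D          ≡⟨ *-distribʳ-+ (2 ^ D) c₀ c₁ ⟩
  c₀ * 2 ^ D + c₁ * 2 ^ D    ≡⟨ cong₂ _+_ eq₀ eq₁ ⟩
  v * 2 ^ n + v * 2 ^ n      ≡⟨ double v (2 ^ n) ⟩
  v * 2 ^ suc n              ∎)
  where
  open ≡-Reasoning
  c₀ = count n (λ x → P (false ∷ x))
  c₁ = count n (λ x → P (true ∷ x))
  double : ∀ v p → v * p + v * p ≡ v * (2 * p)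
  double = solve-∀

density-split : ∀ {n P v₀ v₁ v D} → Density n (λ x → P (false ∷ x)) v₀ D → Density n (λ x → P (true ∷ x)) v₁ D →
                v₀ + v₁ ≡ v → Density (suc n) P v (suc D)
density-split {n} {P} {v₀} {v₁} {v} {D} (density eq₀) (density eq₁) refl = density (begin
  (c₀ + c₁) * 2 ^ suc D                  ≡⟨ spread c₀ c₁ (2 ^ D) ⟩
  2 * (c₀ * 2 ^ D + c₁ * 2 ^ D)          ≡⟨ cong (2 *_) (cong₂ _+_ eq₀ eq₁) ⟩
  2 * (v₀ * 2 ^ n + v₁ * 2 ^ n)          ≡⟨ spread v₀ v₁ (2 ^ n) ⟨
  (v₀ + v₁) * 2 ^ suc n                  ∎)
  where
  open ≡-Reasoning
  c₀ = count n (λ x → P (false ∷ x))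
  c₁ = count n (λ x → P (true ∷ x))
  spread : ∀ u v p → (u + v) * (2 * p) ≡ 2 * (u * p + v * p)
  spread = solve-∀

-- Balls and their sizes

δ : Bool → Bool → ℕ
δ x y = if x xor y then 1 else 0

progress : ∀ {n} → Vec Bool n → Vec Bool n → Vec Bool n → ℕ
progress []       []       []       = 0
progress (a ∷ as) (b ∷ bs) (x ∷ xs) = (if a xor b then δ x a else 0) + progress as bs xs

tieBreak : ∀ {n} → Vec Bool n → Vec Bool n → Vec Bool n → Bool
tieBreak []       []       []       = false
tieBreak (a ∷ as) (b ∷ bs) (x ∷ xs) = if a xor b then x xor a else tieBreak as bs xs

ball : ∀ {n} → ℕ → Vec Bool n → Vec Bool n → Vec Bool n → Bool
ball s a b x = 2 * progress a b x <ᵇ (if tieBreak a b x then suc s else s)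

2*m<ᵇn≡m<ᵇ⌈n/2⌉ : ∀ m n → (2 * m <ᵇ n) ≡ (m <ᵇ ⌈ n /2⌉)
2*m<ᵇn≡m<ᵇ⌈n/2⌉ zero    zero          = refl
2*m<ᵇn≡m<ᵇ⌈n/2⌉ zero    (suc n)       = refl
2*m<ᵇn≡m<ᵇ⌈n/2⌉ (suc m) zero          = refl
2*m<ᵇn≡m<ᵇ⌈n/2⌉ (suc m) (suc zero)    = refl
2*m<ᵇn≡m<ᵇ⌈n/2⌉ (suc m) (suc (suc n)) = trans (cong (_<ᵇ suc (suc n)) (*-suc 2 m)) (2*m<ᵇn≡m<ᵇ⌈n/2⌉ m n)

density-progress< : ∀ r {n} (a b : Vec Bool n) →
                    Density n (λ x → progress a b x <ᵇ r) (binSum (dist a b) r) (dist a b)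
density-progress< zero    a           b           = density-empty
density-progress< (suc r) []          []          = density (cong (_* 1) (sym (binSum-zero r)))
density-progress< (suc r) (false ∷ a) (false ∷ b) = density-double IH IH where IH = density-progress< (suc r) a b
density-progress< (suc r) (true ∷ a)  (true ∷ b)  = density-double IH IH where IH = density-progress< (suc r) a b
density-progress< (suc r) (false ∷ a) (true ∷ b)  =
  density-split (density-progress< (suc r) a b) (density-progress< r a b) (sym (binSum-pascal (dist a b) r))
density-progress< (suc r) (true ∷ a)  (false ∷ b) =
  density-split (density-progress< r a b) (density-progress< (suc r) a b)
                (trans (+-comm (binSum (dist a b) r) _) (sym (binSum-pascal (dist a b) r)))

density-2*progress< : ∀ s {n} (a b : Vec Bool n) →
                      Density n (λ x → 2 * progress a b x <ᵇ s) (binSum (dist a b) ⌈ s /2⌉) (dist a b)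
density-2*progress< s a b =
  density-cong (λ x → sym (2*m<ᵇn≡m<ᵇ⌈n/2⌉ (progress a b x) s)) (density-progress< ⌈ s /2⌉ a b)

density-2*suc-progress< : ∀ s {n} (a b : Vec Bool n) →
                          Density n (λ x → 2 * suc (progress a b x) <ᵇ suc s) (binSum (dist a b) ⌊ s /2⌋) (dist a b)
density-2*suc-progress< s a b =
  density-cong (λ x → sym (2*m<ᵇn≡m<ᵇ⌈n/2⌉ (suc (progress a b x)) (suc s))) (density-progress< ⌊ s /2⌋ a b)

density-ball : ∀ s {n D} (a b : Vec Bool n) → dist a b ≡ suc D →
               Density n (ball s a b) (binSum D ⌈ s /2⌉ + binSum D ⌊ s /2⌋) (suc D)
density-ball s []          []          ()
density-ball s (false ∷ a) (false ∷ b) eq   = density-double IH IH where IH = density-ball s a b eq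
density-ball s (true ∷ a)  (true ∷ b)  eq   = density-double IH IH where IH = density-ball s a b eq
density-ball s (false ∷ a) (true ∷ b)  refl = density-split (density-2*progress< s a b) (density-2*suc-progress< s a b) refl
density-ball s (true ∷ a)  (false ∷ b) refl =
  density-split (density-2*suc-progress< s a b) (density-2*progress< s a b) (+-comm (binSum (dist a b) ⌊ s /2⌋) _)

ball-density : ∀ {n s} → 1 ≤ s → (a b : Vec Bool n) → 1 ≤ dist a b → Density n (ball s a b) (V (dist a b) s) (dist a b)
ball-density s≥1 a b d≥1 with dist a b in eq
ball-density s≥1 a b () | zero
ball-density s≥1 a b d≥1 | suc D = subst (λ v → Density _ (ball _ a b) v (suc D)) (sym (V-halves D s≥1)) (density-ball _ a b eq)

-- Disjointness of the balls

δ-defect : ∀ a b x → δ x b + 2 * (if a xor b then δ x a else 0) ≡ δ a b + δ x a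
δ-defect false false false = refl
δ-defect false false true  = refl
δ-defect false true  false = refl
δ-defect false true  true  = refl
δ-defect true  false false = refl
δ-defect true  false true  = refl
δ-defect true  true  false = refl
δ-defect true  true  true  = refl

progress-defect : ∀ {n} (a b x : Vec Bool n) → dist x b + 2 * progress a b x ≡ dist a b + dist x a
progress-defect []       []       []       = refl
progress-defect (a ∷ as) (b ∷ bs) (x ∷ xs) = begin
  (δ x b + dist xs bs) + 2 * (h + progress as bs xs)    ≡⟨ regroup (δ x b) (dist xs bs) h (progress as bs xs) ⟩
  (δ x b + 2 * h) + (dist xs bs + 2 * progress as bs xs) ≡⟨ cong₂ _+_ (δ-defect a b x) (progress-defect as bs xs) ⟩
  (δ a b + δ x a) + (dist as bs + dist xs as)           ≡⟨ interchange (δ a b) (δ x a) (dist as bs) (dist xs as) ⟩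
  (δ a b + dist as bs) + (δ x a + dist xs as)           ∎
  where
  open ≡-Reasoning
  h = if a xor b then δ x a else 0
  regroup : ∀ d D h p → (d + D) + 2 * (h + p) ≡ (d + 2 * h) + (D + 2 * p)
  regroup = solve-∀

0<m+suc : ∀ m n → 0 < m + suc n
0<m+suc m n = ≤-trans z<s (m≤n+m (suc n) m)

-- At the first coordinate where aᵢ ≠ bᵢ or aⱼ ≠ bⱼ, the two tie-breaks force x to agree with bⱼ
-- against aᵢ, or with bᵢ against aⱼ.
tieBreaks⇒progress : ∀ {n} (aᵢ bᵢ aⱼ bⱼ x : Vec Bool n) → T (tieBreak aᵢ bᵢ x) → T (tieBreak aⱼ bⱼ x) →
                     0 < progress aᵢ bⱼ x + progress aⱼ bᵢ x
tieBreaks⇒progress []            []            []            []            []           () _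
tieBreaks⇒progress (false ∷ _)   (true ∷ _)    _             _             (false ∷ _)  () _
tieBreaks⇒progress (false ∷ _)   (true ∷ _)    _             (true ∷ _)    (true ∷ _)   _  _  = z<s
tieBreaks⇒progress (false ∷ _)   (true ∷ _)    (true ∷ _)    (false ∷ _)   (true ∷ _)   _  ()
tieBreaks⇒progress (false ∷ aᵢ)  (true ∷ bᵢ)   (false ∷ aⱼ)  (false ∷ bⱼ)  (true ∷ x)   _  _  = 0<m+suc (progress aᵢ bⱼ x) (progress aⱼ bᵢ x)
tieBreaks⇒progress (true ∷ _)    (false ∷ _)   _             _             (true ∷ _)   () _
tieBreaks⇒progress (true ∷ _)    (false ∷ _)   _             (false ∷ _)   (false ∷ _)  _  _  = z<s
tieBreaks⇒progress (true ∷ _)    (false ∷ _)   (false ∷ _)   (true ∷ _)    (false ∷ _)  _  ()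
tieBreaks⇒progress (true ∷ aᵢ)   (false ∷ bᵢ)  (true ∷ aⱼ)   (true ∷ bⱼ)   (false ∷ x)  _  _  = 0<m+suc (progress aᵢ bⱼ x) (progress aⱼ bᵢ x)
tieBreaks⇒progress _             _             (false ∷ _)   (true ∷ _)    (false ∷ _)  _  ()
tieBreaks⇒progress (false ∷ _)   (false ∷ _)   (false ∷ _)   (true ∷ _)    (true ∷ _)   _  _  = z<s
tieBreaks⇒progress (true ∷ aᵢ)   (true ∷ bᵢ)   (false ∷ aⱼ)  (true ∷ bⱼ)   (true ∷ x)   _  _  = 0<m+suc (progress aᵢ bⱼ x) (progress aⱼ bᵢ x)
tieBreaks⇒progress _             _             (true ∷ _)    (false ∷ _)   (true ∷ _)   _  ()
tieBreaks⇒progress (false ∷ aᵢ)  (false ∷ bᵢ)  (true ∷ aⱼ)   (false ∷ bⱼ)  (false ∷ x)  _  _  = 0<m+suc (progress aᵢ bⱼ x) (progress aⱼ bᵢ x)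
tieBreaks⇒progress (true ∷ _)    (true ∷ _)    (true ∷ _)    (false ∷ _)   (false ∷ _)  _  _  = z<s
tieBreaks⇒progress (false ∷ aᵢ)  (false ∷ bᵢ)  (false ∷ aⱼ)  (false ∷ bⱼ)  (_ ∷ x)      tᵢ tⱼ = tieBreaks⇒progress aᵢ bᵢ aⱼ bⱼ x tᵢ tⱼ
tieBreaks⇒progress (true ∷ aᵢ)   (true ∷ bᵢ)   (true ∷ aⱼ)   (true ∷ bⱼ)   (_ ∷ x)      tᵢ tⱼ = tieBreaks⇒progress aᵢ bᵢ aⱼ bⱼ x tᵢ tⱼ
tieBreaks⇒progress (false ∷ _)   (false ∷ _)   (true ∷ _)    (true ∷ _)    (true ∷ _)   _  _  = z<s
tieBreaks⇒progress (false ∷ aᵢ)  (false ∷ bᵢ)  (true ∷ aⱼ)   (true ∷ bⱼ)   (false ∷ x)  _  _  = 0<m+suc (progress aᵢ bⱼ x) (progress aⱼ bᵢ x)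
tieBreaks⇒progress (true ∷ _)    (true ∷ _)    (false ∷ _)   (false ∷ _)   (false ∷ _)  _  _  = z<s
tieBreaks⇒progress (true ∷ aᵢ)   (true ∷ bᵢ)   (false ∷ aⱼ)  (false ∷ bⱼ)  (true ∷ x)   _  _  = 0<m+suc (progress aᵢ bⱼ x) (progress aⱼ bᵢ x)

ball-margin : ∀ {n s} (a b x : Vec Bool n) → T (2 * progress a b x <ᵇ (if tieBreak a b x then suc s else s)) →
              2 * progress a b x + (if tieBreak a b x then 0 else 1) ≤ s
ball-margin {s = s} a b x x∈ball with tieBreak a b x
... | true  = subst (_≤ s) (sym (+-identityʳ _)) (s≤s⁻¹ (<ᵇ⇒< _ (suc s) x∈ball))
... | false = subst (_≤ s) (+-comm 1 _) (<ᵇ⇒< _ s x∈ball)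

slack-positive : ∀ {n} (aᵢ bᵢ aⱼ bⱼ x : Vec Bool n) →
  0 < 2 * (progress aᵢ bⱼ x + progress aⱼ bᵢ x) + ((if tieBreak aᵢ bᵢ x then 0 else 1) + (if tieBreak aⱼ bⱼ x then 0 else 1))
slack-positive aᵢ bᵢ aⱼ bⱼ x with tieBreak aᵢ bᵢ x in tᵢ | tieBreak aⱼ bⱼ x in tⱼ
... | false | _     = ≤-trans z<s (m≤n+m _ (2 * (progress aᵢ bⱼ x + progress aⱼ bᵢ x)))
... | true  | false = ≤-trans z<s (m≤n+m _ (2 * (progress aᵢ bⱼ x + progress aⱼ bᵢ x)))
... | true  | true  = ≤-trans z<s (≤-trans (*-monoʳ-≤ 2 both-tied) (m≤m+n _ 0))
  where both-tied = tieBreaks⇒progress aᵢ bᵢ aⱼ bⱼ x (subst T (sym tᵢ) _) (subst T (sym tⱼ) _)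

module _ {n} (t sᵢ sⱼ : ℕ) (aᵢ bᵢ aⱼ bⱼ : Vec Bool n)
         (eqᵢ : dist aᵢ bᵢ ≡ t + sᵢ) (eqⱼ : dist aⱼ bⱼ ≡ t + sⱼ) (cross : dist aᵢ bⱼ + dist aⱼ bᵢ ≤ 2 * t) where

  cross-defect : ∀ x → 2 * (progress aᵢ bⱼ x + progress aⱼ bᵢ x) + (sᵢ + sⱼ) ≤ 2 * progress aᵢ bᵢ x + 2 * progress aⱼ bⱼ x
  cross-defect x = +-cancelˡ-≤ (dist x bᵢ + dist x bⱼ) _ _ (begin
    (dist x bᵢ + dist x bⱼ) + (2 * (qᵢⱼ + qⱼᵢ) + (sᵢ + sⱼ))
      ≡⟨ regroup₁ (dist x bᵢ) (dist x bⱼ) qᵢⱼ qⱼᵢ (sᵢ + sⱼ) ⟩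
    (dist x bⱼ + 2 * qᵢⱼ) + (dist x bᵢ + 2 * qⱼᵢ) + (sᵢ + sⱼ)
      ≡⟨ cong (_+ (sᵢ + sⱼ)) (cong₂ _+_ (progress-defect aᵢ bⱼ x) (progress-defect aⱼ bᵢ x)) ⟩
    (dist aᵢ bⱼ + dist x aᵢ) + (dist aⱼ bᵢ + dist x aⱼ) + (sᵢ + sⱼ)
      ≡⟨ regroup₂ (dist aᵢ bⱼ) (dist x aᵢ) (dist aⱼ bᵢ) (dist x aⱼ) (sᵢ + sⱼ) ⟩
    (dist aᵢ bⱼ + dist aⱼ bᵢ) + (dist x aᵢ + dist x aⱼ + (sᵢ + sⱼ))
      ≤⟨ +-monoˡ-≤ _ cross ⟩
    2 * t + (dist x aᵢ + dist x aⱼ + (sᵢ + sⱼ))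
      ≡⟨ regroup₃ t sᵢ sⱼ (dist x aᵢ) (dist x aⱼ) ⟩
    ((t + sᵢ) + dist x aᵢ) + ((t + sⱼ) + dist x aⱼ)
      ≡⟨ cong₂ (λ dᵢ dⱼ → (dᵢ + dist x aᵢ) + (dⱼ + dist x aⱼ)) eqᵢ eqⱼ ⟨
    (dist aᵢ bᵢ + dist x aᵢ) + (dist aⱼ bⱼ + dist x aⱼ)
      ≡⟨ cong₂ _+_ (progress-defect aᵢ bᵢ x) (progress-defect aⱼ bⱼ x) ⟨
    (dist x bᵢ + 2 * pᵢ) + (dist x bⱼ + 2 * pⱼ)
      ≡⟨ interchange (dist x bᵢ) (2 * pᵢ) (dist x bⱼ) (2 * pⱼ) ⟩
    (dist x bᵢ + dist x bⱼ) + (2 * pᵢ + 2 * pⱼ) ∎)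
    where
    open ≤-Reasoning
    pᵢ = progress aᵢ bᵢ x
    pⱼ = progress aⱼ bⱼ x
    qᵢⱼ = progress aᵢ bⱼ x
    qⱼᵢ = progress aⱼ bᵢ x
    regroup₁ : ∀ u v q r S → (u + v) + (2 * (q + r) + S) ≡ (v + 2 * q) + (u + 2 * r) + S
    regroup₁ = solve-∀
    regroup₂ : ∀ a b c d S → (a + b) + (c + d) + S ≡ (a + c) + (b + d + S)
    regroup₂ = solve-∀
    regroup₃ : ∀ t sᵢ sⱼ u v → 2 * t + (u + v + (sᵢ + sⱼ)) ≡ ((t + sᵢ) + u) + ((t + sⱼ) + v)
    regroup₃ = solve-∀

  balls-disjoint : ∀ x → T (ball sᵢ aᵢ bᵢ x) → T (ball sⱼ aⱼ bⱼ x) → ⊥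
  balls-disjoint x x∈ballᵢ x∈ballⱼ = <⇒≱ (m<n+m (sᵢ + sⱼ) (slack-positive aᵢ bᵢ aⱼ bⱼ x)) (begin
    (2 * q + (eᵢ + eⱼ)) + (sᵢ + sⱼ)   ≡⟨ xy∙z≈xz∙y (2 * q) (eᵢ + eⱼ) (sᵢ + sⱼ) ⟩
    (2 * q + (sᵢ + sⱼ)) + (eᵢ + eⱼ)   ≤⟨ +-monoˡ-≤ (eᵢ + eⱼ) (cross-defect x) ⟩
    (2 * pᵢ + 2 * pⱼ) + (eᵢ + eⱼ)     ≡⟨ interchange (2 * pᵢ) (2 * pⱼ) eᵢ eⱼ ⟩
    (2 * pᵢ + eᵢ) + (2 * pⱼ + eⱼ)     ≤⟨ +-mono-≤ (ball-margin aᵢ bᵢ x x∈ballᵢ) (ball-margin aⱼ bⱼ x x∈ballⱼ) ⟩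
    sᵢ + sⱼ                           ∎)
    where
    open ≤-Reasoning
    pᵢ = progress aᵢ bᵢ x
    pⱼ = progress aⱼ bⱼ x
    q = progress aᵢ bⱼ x + progress aⱼ bᵢ x
    eᵢ = if tieBreak aᵢ bᵢ x then 0 else 1
    eⱼ = if tieBreak aⱼ bⱼ x then 0 else 1

∑-const : ∀ m c → ∑[ i < m ] c ≡ m * c
∑-const zero    c = refl
∑-const (suc m) c = cong (c +_) (∑-const m c)

∑-mono-≤ : ∀ {m} {f g : Fin m → ℕ} → (∀ i → f i ≤ g i) → ∑[ i < m ] f i ≤ ∑[ i < m ] g i
∑-mono-≤ {zero}  f≤g = z≤n
∑-mono-≤ {suc m} f≤g = +-mono-≤ (f≤g zero) (∑-mono-≤ (λ i → f≤g (suc i)))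

∑-indicator≤1 : ∀ {m} (b : Fin m → Bool) → (∀ i j → T (b i) → T (b j) → i ≡ j) →
                ∑[ i < m ] (if b i then 1 else 0) ≤ 1
∑-indicator≤1 {zero}  b unique = z≤n
∑-indicator≤1 {suc m} b unique with b zero in b₀
... | false = ∑-indicator≤1 (λ i → b (suc i)) (λ i j bᵢ bⱼ → Fin.suc-injective (unique (suc i) (suc j) bᵢ bⱼ))
... | true  = ≤-reflexive (cong suc (trans (∑.sum-cong-≗ rest-false) (∑.sum-replicate-zero m)))
  where
  rest-false : ∀ i → (if b (suc i) then 1 else 0) ≡ 0
  rest-false i with b (suc i) in bᵢ
  ... | false = refl
  ... | true with () ← unique zero (suc i) (subst T (sym b₀) _) (subst T (sym bᵢ) _)

∑-count≤2^n : ∀ n {m} (P : Fin m → Vec Bool n → Bool) → (∀ x i j → T (P i x) → T (P j x) → i ≡ j) →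
              ∑[ i < m ] count n (P i) ≤ 2 ^ n
∑-count≤2^n zero    P disjoint = ∑-indicator≤1 (λ i → P i []) (disjoint [])
∑-count≤2^n (suc n) P disjoint = begin
  ∑[ i < _ ] (count n (λ x → P i (false ∷ x)) + count n (λ x → P i (true ∷ x)))
    ≡⟨ ∑.∑-distrib-+ (λ i → count n (λ x → P i (false ∷ x))) (λ i → count n (λ x → P i (true ∷ x))) ⟩
  ∑[ i < _ ] count n (λ x → P i (false ∷ x)) + ∑[ i < _ ] count n (λ x → P i (true ∷ x))
    ≤⟨ +-mono-≤ (∑-count≤2^n n _ (λ x → disjoint (false ∷ x))) (∑-count≤2^n n _ (λ x → disjoint (true ∷ x))) ⟩
  2 ^ n + 2 ^ n
    ≡⟨ cong (2 ^ n +_) (+-identityʳ (2 ^ n)) ⟨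
  2 ^ suc n ∎
  where open ≤-Reasoning

toℚᵘ-/ : ∀ p q .{{_ : NonZero q}} → ℚ.toℚᵘ (p ℚ./ q) ≃ᵘ p /ᵘ q
toℚᵘ-/ p (suc q) = toℚᵘ-fromℚᵘ (mkℚᵘ p q)

/-cross : ∀ a b p q .{{_ : NonZero p}} .{{_ : NonZero q}} → a * q ≡ b * p → ℤ.+ a ℚ./ p ≡ ℤ.+ b ℚ./ q
/-cross a b p@(suc _) q@(suc _) eq = toℚᵘ-injective (ℚᵘ.≃-trans (toℚᵘ-/ (ℤ.+ a) p) (ℚᵘ.≃-trans cross (ℚᵘ.≃-sym (toℚᵘ-/ (ℤ.+ b) q))))
  where
  cross : ℤ.+ a /ᵘ p ≃ᵘ ℤ.+ b /ᵘ q
  cross = *≡* (trans (sym (ℤ.pos-* a q)) (trans (cong ℤ.+_ eq) (ℤ.pos-* b p)))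

/-+ : ∀ a b D .{{_ : NonZero D}} → ℤ.+ a ℚ./ D ℚ.+ ℤ.+ b ℚ./ D ≡ ℤ.+ (a + b) ℚ./ D
/-+ a b D@(suc _) = toℚᵘ-injective (ℚᵘ.≃-trans (toℚᵘ-homo-+ (ℤ.+ a ℚ./ D) (ℤ.+ b ℚ./ D))
  (ℚᵘ.≃-trans (ℚᵘ.+-cong (toℚᵘ-/ (ℤ.+ a) D) (toℚᵘ-/ (ℤ.+ b) D))
  (ℚᵘ.≃-trans common (ℚᵘ.≃-sym (toℚᵘ-/ (ℤ.+ (a + b)) D)))))
  where
  common : ℤ.+ a /ᵘ D +ᵘ ℤ.+ b /ᵘ D ≃ᵘ ℤ.+ (a + b) /ᵘ D
  common = *≡* (trans (regroup (ℤ.+ a) (ℤ.+ b) (ℤ.+ D)) (cong (ℤ._* (ℤ.+ D ℤ.* ℤ.+ D)) (sym (ℤ.pos-+ a b))))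
    where
    regroup : ∀ a b d → (a ℤ.* d ℤ.+ b ℤ.* d) ℤ.* d ≡ (a ℤ.+ b) ℤ.* (d ℤ.* d)
    regroup = ℤ-solve-∀

0/D≡0 : ∀ D .{{_ : NonZero D}} → ℤ.+ 0 ℚ./ D ≡ ℚ.0ℚ
0/D≡0 D@(suc _) = toℚᵘ-injective (ℚᵘ.≃-trans (toℚᵘ-/ (ℤ.+ 0) D) (*≡* refl))

/≤1 : ∀ {a D} .{{_ : NonZero D}} → a ≤ D → ℤ.+ a ℚ./ D ≤ℚ 1ℚ
/≤1 {a} {D@(suc _)} a≤D = toℚᵘ-cancel-≤ (ℚᵘ.≤-respˡ-≃ (ℚᵘ.≃-sym (toℚᵘ-/ (ℤ.+ a) D))
  (*≤* (subst₂ ℤ._≤_ (sym (ℤ.*-identityʳ (ℤ.+ a))) (sym (ℤ.*-identityˡ (ℤ.+ D))) (ℤ.+≤+ a≤D))))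

Σℚ-suc : ∀ {m} (f : Fin (suc m) → ℚ.ℚ) → Σℚ f ≡ f zero ℚ.+ Σℚ (λ i → f (suc i))
Σℚ-suc {m} f = cong (λ xs → f zero ℚ.+ foldr ℚ._+_ ℚ.0ℚ xs)
  (trans (map-tabulate suc f) (sym (map-tabulate (λ i → i) (λ i → f (suc i)))))

Σℚ-/ : ∀ {m} D .{{_ : NonZero D}} (f : Fin m → ℚ.ℚ) (c : Fin m → ℕ) → (∀ i → f i ≡ ℤ.+ c i ℚ./ D) →
       Σℚ f ≡ ℤ.+ (∑[ i < m ] c i) ℚ./ D
Σℚ-/ {zero}  D f c f≡c/D = sym (0/D≡0 D)
Σℚ-/ {suc m} D f c f≡c/D = begin
  Σℚ f                                                 ≡⟨ Σℚ-suc f ⟩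
  f zero ℚ.+ Σℚ (λ i → f (suc i))                      ≡⟨ cong₂ ℚ._+_ (f≡c/D zero) (Σℚ-/ D _ _ (λ i → f≡c/D (suc i))) ⟩
  ℤ.+ c zero ℚ./ D ℚ.+ ℤ.+ (∑[ i < m ] c (suc i)) ℚ./ D ≡⟨ /-+ (c zero) _ D ⟩
  ℤ.+ (∑[ i < suc m ] c i) ℚ./ D                       ∎
  where open ≡-Reasoning

-- The packing bound

module Packing {n m} (t : ℕ) (a b : Fin m → Vec Bool n) (s : Fin m → ℕ) (s≥1 : ∀ i → 1 ≤ s i)
               (dist≡ : ∀ i → dist (a i) (b i) ≡ t + s i) (cross : Cross t a b) where

  Ball : Fin m → Vec Bool n → Bool
  Ball i = ball (s i) (a i) (b i)

  Ball-count : ∀ i → count n (Ball i) * 2 ^ (t + s i) ≡ V (t + s i) (s i) * 2 ^ n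
  Ball-count i = subst (λ D → count n (Ball i) * 2 ^ D ≡ V D (s i) * 2 ^ n) (dist≡ i)
    (Density.count*2^D≡v*2^n (ball-density (s≥1 i) (a i) (b i) (subst (1 ≤_) (sym (dist≡ i)) 1≤t+s)))
    where 1≤t+s = ≤-trans (s≥1 i) (m≤n+m (s i) t)

  ∑-Ball-count≤2^n : ∑[ i < m ] count n (Ball i) ≤ 2 ^ n
  ∑-Ball-count≤2^n = ∑-count≤2^n n Ball disjoint
    where
    disjoint : ∀ x i j → T (Ball i x) → T (Ball j x) → i ≡ j
    disjoint x i j x∈i x∈j with i Fin.≟ j
    ... | yes i≡j = i≡j
    ... | no  i≢j = ⊥-elim (balls-disjoint t (s i) (s j) (a i) (b i) (a j) (b j) (dist≡ i) (dist≡ j) (cross i j i≢j) x x∈i x∈j)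

  Σ-Vfrac≤1 : Σℚ (λ i → Vfrac (t + s i) (s i)) ≤ℚ 1ℚ
  Σ-Vfrac≤1 = subst (_≤ℚ 1ℚ) (sym (Σℚ-/ (2 ^ n) {{2^n≢0}} _ (λ i → count n (Ball i)) Vfrac≡))
                    (/≤1 {{2^n≢0}} ∑-Ball-count≤2^n)
    where
    2^n≢0 = m^n≢0 2 n
    Vfrac≡ : ∀ i → Vfrac (t + s i) (s i) ≡ (ℤ.+ count n (Ball i) ℚ./ 2 ^ n) {{2^n≢0}}
    Vfrac≡ i = /-cross (V (t + s i) (s i)) (count n (Ball i)) (2 ^ (t + s i)) (2 ^ n)
                       {{m^n≢0 2 (t + s i)}} {{2^n≢0}} (sym (Ball-count i))

  m*V≤2^[t+s] : ∀ s₀ → 1 ≤ s₀ → (∀ i → s₀ ≤ s i) → m * V (t + s₀) s₀ ≤ 2 ^ (t + s₀)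
  m*V≤2^[t+s] s₀ s₀≥1 s₀≤s = *-cancelʳ-≤ (m * V₀) (2 ^ (t + s₀)) (2 ^ n) {{m^n≢0 2 n}} (begin
    m * V₀ * 2 ^ n                                 ≡⟨ *-assoc m V₀ (2 ^ n) ⟩
    m * (V₀ * 2 ^ n)                               ≡⟨ ∑-const m (V₀ * 2 ^ n) ⟨
    ∑[ i < m ] (V₀ * 2 ^ n)                        ≤⟨ ∑-mono-≤ each ⟩
    ∑[ i < m ] (count n (Ball i) * 2 ^ (t + s₀))   ≡⟨ ∑.*-distribʳ-sum (2 ^ (t + s₀)) (λ i → count n (Ball i)) ⟨
    ∑[ i < m ] count n (Ball i) * 2 ^ (t + s₀)     ≤⟨ *-monoˡ-≤ (2 ^ (t + s₀)) ∑-Ball-count≤2^n ⟩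
    2 ^ n * 2 ^ (t + s₀)                           ≡⟨ *-comm (2 ^ n) (2 ^ (t + s₀)) ⟩
    2 ^ (t + s₀) * 2 ^ n                           ∎)
    where
    open ≤-Reasoning
    V₀ = V (t + s₀) s₀
    each : ∀ i → V₀ * 2 ^ n ≤ count n (Ball i) * 2 ^ (t + s₀)
    each i = *-cancelʳ-≤ (V₀ * 2 ^ n) (count n (Ball i) * 2 ^ (t + s₀)) (2 ^ (t + s i)) {{m^n≢0 2 (t + s i)}} (begin
      V₀ * 2 ^ n * 2 ^ (t + s i)                       ≡⟨ *-CS.xy∙z≈xz∙y V₀ (2 ^ n) (2 ^ (t + s i)) ⟩
      V₀ * 2 ^ (t + s i) * 2 ^ n                       ≤⟨ *-monoˡ-≤ (2 ^ n) (V-ratio-mono t s₀≥1 (s₀≤s i)) ⟩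
      V (t + s i) (s i) * 2 ^ (t + s₀) * 2 ^ n         ≡⟨ *-CS.xy∙z≈xz∙y (V (t + s i) (s i)) (2 ^ (t + s₀)) (2 ^ n) ⟩
      V (t + s i) (s i) * 2 ^ n * 2 ^ (t + s₀)         ≡⟨ cong (_* 2 ^ (t + s₀)) (Ball-count i) ⟨
      count n (Ball i) * 2 ^ (t + s i) * 2 ^ (t + s₀)  ≡⟨ *-CS.xy∙z≈xz∙y (count n (Ball i)) (2 ^ (t + s i)) (2 ^ (t + s₀)) ⟩
      count n (Ball i) * 2 ^ (t + s₀) * 2 ^ (t + s i)  ∎)

f′-bound : ∀ t s₀ {n m} → 1 ≤ s₀ → (a b : Fin m → Vec Bool n) → (∀ i → t + s₀ ≤ dist (a i) (b i)) → Cross t a b →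
           m * V (t + s₀) s₀ ≤ 2 ^ (t + s₀)
f′-bound t s₀ s₀≥1 a b far cross =
  Packing.m*V≤2^[t+s] t a b excess (λ i → ≤-trans s₀≥1 (s₀≤excess i)) dist≡ cross s₀ s₀≥1 s₀≤excess
  where
  excess = λ i → dist (a i) (b i) ∸ t
  dist≡ : ∀ i → dist (a i) (b i) ≡ t + excess i
  dist≡ i = sym (m+[n∸m]≡n (≤-trans (m≤m+n t s₀) (far i)))
  s₀≤excess : ∀ i → s₀ ≤ excess i
  s₀≤excess i = +-cancelˡ-≤ t s₀ (excess i) (subst (t + s₀ ≤_) (dist≡ i) (far i))

theorem3p1 :
    ((n t m : ℕ) → t < n → (a b : Fin m → Vec Bool n) → (s : Fin m → ℕ)
      → (∀ i → 1 ≤ s i) → (∀ i → dist (a i) (b i) ≡ t + s i) → Cross t a b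
      → Σℚ (λ i → Vfrac (t + s i) (s i)) ≤ℚ 1ℚ)
    × ((n t m : ℕ) → t < n → (a b : Fin m → Vec Bool n) → (s : Fin m → ℕ)
      → (∀ i → 1 ≤ s i) → (∀ i → dist (a i) (b i) ≡ t + s i) → Cross t a b
      → (s₀ : ℕ) → 1 ≤ s₀ → (∀ i → s₀ ≤ s i)
      → m * V (t + s₀) s₀ ≤ 2 ^ (t + s₀))
    × ((t n m : ℕ) → t < n → (a b : Fin m → Vec Bool n)
      → (∀ i → t + 1 ≤ dist (a i) (b i)) → Cross t a b
      → m ≤ 2 ^ (t + 1))
    × ((t s n m : ℕ) → 1 ≤ s → t < n → (a b : Fin m → Vec Bool n)
      → (∀ i → t + s ≤ dist (a i) (b i)) → Cross t a b
      → m * V (t + s) s ≤ 2 ^ (t + s))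
theorem3p1 =
    (λ n t m _ a b s s≥1 dist≡ cross → Packing.Σ-Vfrac≤1 t a b s s≥1 dist≡ cross)
  , (λ n t m _ a b s s≥1 dist≡ cross → Packing.m*V≤2^[t+s] t a b s s≥1 dist≡ cross)
  , (λ t n m _ a b far cross → subst (_≤ 2 ^ (t + 1)) (*-identityʳ m) (f′-bound t 1 z<s a b far cross))
  , (λ t s n m s≥1 _ a b far cross → f′-bound t s s≥1 a b far cross)
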